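{- For any connected graph $G\in Free(\{K_{1,3},hammer\})$ at least one of the following holds: (i) $G$ is a chordless cycle; (ii) $G$ contains $C_6$ as an induced subgraph; (iii) $G$ has a pendant vertex (a vertex of degree one); (iv) $G\in Free(\{P_5\})$; (v) $G\in[Free(\{O_3\})]_5$, i.e. one can delete at most $5$ vertices of $G$ so that the resulting graph contains no three pairwise nonadjacent vertices.
   Context: All graphs are finite and simple. $Free(\mathcal S)$ is the class of graphs containing no member of $\mathcal S$ as an induced subgraph. $K_{1,3}$ is the claw, $C_n$ the chordless cycle and $P_n$ the path on $n$ vertices, $O_n$ the edgeless graph on $n$ vertices. The graph $hammer$ has vertex set $\{x_1,\dots,x_5\}$ and edge set $\{x_1x_2,x_1x_3,x_2x_3,x_1x_4,x_4x_5\}$. For a hereditary class $\mathcal X$ and an integer $k$, $[\mathcal X]_k$ is the set of graphs from which one can delete at most $k$ vertices so that the result belongs to $\mathcal X$. -}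

module Defs where

open import Data.Nat using (ℕ; zero; suc; _+_; _≤_; _≡ᵇ_)
open import Data.Fin using (Fin; toℕ)
open import Data.Fin.Properties using (_≟_)
open import Data.Bool using (Bool; true; false; _∧_; _∨_; not)
open import Relation.Nullary.Decidable using (⌊_⌋)
open import Data.Product using (Σ; ∃; _×_; _,_)
open import Relation.Binary.PropositionalEquality using (_≡_)
open import Relation.Nullary using (¬_)
open import Function.Definitions using (Injective)
open import Function.Bundles using (_↔_; Inverse)

-- The raw relation `rel`
-- is arbitrary; the adjacency is its symmetric closure with loops removed,
-- so every graph is simple (undirected, loopless) by construction, and
-- every finite simple graph is representable (take rel = adjacency).
record Graph : Set where
  constructor mkGraph
  field
    size : ℕ
    rel  : Fin size → Fin size → Bool

open Graph public

V : Graph → Set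
V G = Fin (size G)

adj : (G : Graph) → V G → V G → Bool
adj G i j = not ⌊ i ≟ j ⌋ ∧ (rel G i j ∨ rel G j i)

_≤ᵢ_ : Graph → Graph → Set
H ≤ᵢ G = Σ (V H → V G) λ f →
  Injective _≡_ _≡_ f × (∀ i j → adj G (f i) (f j) ≡ adj H i j)

_≅_ : Graph → Graph → Set
G ≅ H = Σ (V G ↔ V H) λ f →
  ∀ i j → adj H (Inverse.to f i) (Inverse.to f j) ≡ adj G i j

Free : (Graph → Set) → Graph → Set
Free S G = ∀ H → S H → ¬ (H ≤ᵢ G)

data Reach (G : Graph) : V G → V G → Set where
  here : ∀ {u} → Reach G u u
  step : ∀ {u v w} → adj G u v ≡ true → Reach G v w → Reach G u w

Connected : Graph → Set
Connected G = ∀ u v → Reach G u v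

countTrue : ∀ {n} → (Fin n → Bool) → ℕ
countTrue {zero} f = 0
countTrue {suc n} f = (if' f Fin.zero) + countTrue (λ i → f (Fin.suc i))
  where
  if' : (Fin (suc n) → Bool) → Fin (suc n) → ℕ
  if' g i with g i
  ... | true = 1
  ... | false = 0

degree : (G : Graph) → V G → ℕ
degree G v = countTrue (adj G v)

P : ℕ → Graph
P n = mkGraph n (λ i j → toℕ j ≡ᵇ suc (toℕ i))

-- cycle C_n (meaningful for n ≥ 3): i ~ i+1 and (n-1) ~ 0
C : ℕ → Graph
C n = mkGraph n (λ i j → (toℕ j ≡ᵇ suc (toℕ i)) ∨ ((toℕ i ≡ᵇ 0) ∧ (suc (toℕ j) ≡ᵇ n)))

O : ℕ → Graph
O n = mkGraph n (λ _ _ → false)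

claw : Graph
claw = mkGraph 4 (λ i j → (toℕ i ≡ᵇ 0) ∧ not (toℕ j ≡ᵇ 0))

-- hammer on x1..x5 = vertices 0..4 ; edges x1x2,x1x3,x2x3,x1x4,x4x5
hammerRel : Fin 5 → Fin 5 → Bool
hammerRel i j = e (toℕ i) (toℕ j)
  where
  e : ℕ → ℕ → Bool
  e 0 1 = true
  e 0 2 = true
  e 1 2 = true
  e 0 3 = true
  e 3 4 = true
  e _ _ = false

hammer : Graph
hammer = mkGraph 5 hammerRel

ClawOrHammer : Graph → Set
ClawOrHammer H = (H ≡ claw) ⊎' (H ≡ hammer)
  where
  open import Data.Sum using () renaming (_⊎_ to _⊎'_)

Single : Graph → Graph → Set
Single H₀ H = H ≡ H₀

IsChordlessCycle : Graph → Set
IsChordlessCycle G = Σ ℕ λ k → (3 ≤ k) × (G ≅ C k)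

-- [X]_k : deleting at most k vertices yields a graph in X.  The graph
-- obtained by deleting a vertex set is (up to isomorphism) an induced
-- subgraph H on the remaining |V G| - |S| vertices.
Deletable : (Graph → Set) → ℕ → Graph → Set
Deletable X k G = Σ Graph λ H → (H ≤ᵢ G) × (size G ≤ size H + k) × X H

-- Suppose G has no pendant vertex and no induced C₆.  If G has an induced P₆, a vertex outside
-- it that touches it can only see its two ends (otherwise a claw, hammer or C₆ appears).  As the
-- last end has a second neighbour, the window slides forever, tracing a walk whose vertices from
-- the third on are adjacent only to their predecessor and successor; the first repetition of the
-- walk closes an induced cycle which, by connectivity, is all of G.  If G has an induced P₅ = p₀…p₄ but no P₆, each outside vertex sees one of four
-- neighbourhoods on it or none; the vertices on or adjacent to p are closed under adjacency, so
-- by connectivity every outside vertex sees p, and of two nonadjacent ones exactly one sees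
-- {p₀,p₁,p₃,p₄}.  Hence G − p has no three pairwise nonadjacent vertices.  Otherwise G is P₅-free.
-- The finitely many local configurations are decided by a search run by the type checker.
module Submission where

open import Defs
open import Data.Bool using (Bool; true; false; T; _∧_; _∨_; not)
open import Data.Bool.Properties using (T-∧; T-∨; T-≡; ∨-comm; ∨-idem; ∧-zeroʳ; ⇔→≡) renaming (_≟_ to _≟ᴮ_)
open import Data.Empty using (⊥; ⊥-elim)
open import Data.Fin using (Fin; toℕ; #_; fromℕ<; punchIn; punchOut) renaming (zero to fz; suc to fs)
open import Data.Fin.Properties
  using (_≟_; all?; any?; suc-injective; punchIn-injective; punchInᵢ≢i; punchIn-punchOut; toℕ-fromℕ<;
         pigeonhole; toℕ<n; toℕ-injective)
open import Data.List using (List; []; _∷_; concatMap; map; filterᵇ; allFin; mapMaybe; head)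
open import Data.List.Relation.Unary.All using (All; []; _∷_)
open import Data.List.Relation.Unary.All.Properties using (All¬⇒¬Any)
open import Data.List.Relation.Unary.Any using (Any; here; there)
import Data.List.Relation.Unary.Any as Any
open import Data.Maybe using (Maybe; just; nothing; is-just; _<∣>_; to-witness-T)
import Data.Maybe as Maybe
open import Data.Nat using (ℕ; zero; suc; pred; _+_; _*_; _∸_; _<_; _≤_; _≡ᵇ_; z≤n; s≤s; s≤s⁻¹; z<s)
open import Data.Nat.DivMod using (_%_; _/_; m%n<n; m≡m%n+[m/n]*n)
open import Data.Nat.Induction using (<-rec)
open import Data.Nat.Properties
  using (_≤?_; anyUpTo?; ≡ᵇ⇒≡; ≡⇒≡ᵇ; +-suc; +-identityʳ; +-comm; +-assoc; ≤-reflexive; ≤-trans; <-trans;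
         <-≤-trans; <-irrefl; <-cmp; <⇒≤; ≰⇒>; n<1+n; m<n+m; m≤n+m; m+n≤o⇒n≤o; m∸n+n≡m; +-cancelʳ-<;
         +-cancelʳ-≤; m≤n⇒m<n∨m≡n)
  renaming (_≟_ to _≟ℕ_)
open import Data.Product using (Σ; ∃; _×_; _,_; proj₁; proj₂)
open import Data.Sum using (_⊎_; inj₁; inj₂)
import Data.Sum as Sum
open import Data.Vec using (Vec; []; _∷_; lookup; tabulate; replicate)
open import Data.Vec.Functional using () renaming (_∷_ to _◂_)
open import Data.Vec.Properties using (lookup∘tabulate; lookup-replicate) renaming (≡-dec to ≡-dec-Vec)
open import Function using (_∘_)
open import Function.Bundles using (Equivalence; mk⇔; mk↔ₛ′)
open import Function.Definitions using (Injective)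
open import Relation.Binary.Definitions using (tri<; tri≈; tri>)
open import Relation.Binary.PropositionalEquality
open import Relation.Nullary using (¬_; Dec; yes; no; _→-dec_; _×-dec_; ¬?)
open import Relation.Nullary.Decidable using (⌊_⌋; map′; dec⇒maybe; True; toWitness)

adj-irrefl : (G : Graph) (i : V G) → adj G i i ≡ false
adj-irrefl G i with i ≟ i
... | yes _    = refl
... | no i≢i = ⊥-elim (i≢i refl)

adj-sym : (G : Graph) (i j : V G) → adj G i j ≡ adj G j i
adj-sym G i j with i ≟ j | j ≟ i
... | yes _   | yes _   = refl
... | no _    | no _    = ∨-comm (rel G i j) (rel G j i)
... | yes i≡j | no j≢i  = ⊥-elim (j≢i (sym i≡j))
... | no i≢j  | yes j≡i = ⊥-elim (i≢j (sym j≡i))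

adj⇒≢ : (G : Graph) {i j : V G} → adj G i j ≡ true → i ≢ j
adj⇒≢ G {i} i~j refl with () ← trans (sym (adj-irrefl G i)) i~j

Reach-closed : (G : Graph) (Q : V G → Set) → (∀ {x y} → adj G x y ≡ true → Q x → Q y) →
  ∀ {u w} → Reach G u w → Q u → Q w
Reach-closed G Q closed here       q = q
Reach-closed G Q closed (step e r) q = Reach-closed G Q closed r (closed e q)

countTrue-zero : ∀ {n} (f : Fin n → Bool) → (∀ u → f u ≡ false) → countTrue f ≡ 0
countTrue-zero {zero}  f none = refl
countTrue-zero {suc n} f none with f fz | none fz
... | false | _ = countTrue-zero (f ∘ fs) (none ∘ fs)

countTrue-one : ∀ {n} (f : Fin n → Bool) (a : Fin n) → f a ≡ true → (∀ u → f u ≡ true → u ≡ a) →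
  countTrue f ≡ 1
countTrue-one {suc n} f fz fa only with f fz
... | true = cong suc (countTrue-zero (f ∘ fs) others)
  where
  others : ∀ u → f (fs u) ≡ false
  others u with f (fs u) in eq
  ... | false = refl
  ... | true with () ← only (fs u) eq
countTrue-one {suc n} f (fs a) fa only with f fz in eq
... | true with () ← only fz eq
... | false = countTrue-one (f ∘ fs) a fa (λ u e → suc-injective (only (fs u) e))

secondNeighbour : (G : Graph) (v a : V G) → degree G v ≢ 1 → adj G v a ≡ true →
  Σ (V G) λ u → adj G v u ≡ true × u ≢ a
secondNeighbour G v a deg≢1 v~a with any? (λ u → (adj G v u ≟ᴮ true) ×-dec ¬? (u ≟ a))
... | yes found = found
... | no none = ⊥-elim (deg≢1 (countTrue-one (adj G v) a v~a only))
  where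
  only : ∀ u → adj G v u ≡ true → u ≡ a
  only u v~u with u ≟ a
  ... | yes u≡a = u≡a
  ... | no u≢a  = ⊥-elim (none (u , v~u , u≢a))

Adjacency : ℕ → Set
Adjacency n = Fin n → Fin n → Bool

IsInduced : ∀ {n k} → Adjacency n → Adjacency k → (Fin n → Fin k) → Set
IsInduced A M f = Injective _≡_ _≡_ f × (∀ i j → M (f i) (f j) ≡ A i j)

-- H ≤ᵢ G is, definitionally, adj H ↪ adj G.
_↪_ : ∀ {n k} → Adjacency n → Adjacency k → Set
_↪_ {n} {k} A M = Σ (Fin n → Fin k) (IsInduced A M)

isInduced? : ∀ {n k} (A : Adjacency n) (M : Adjacency k) (f : Fin n → Fin k) → Dec (IsInduced A M f)
isInduced? A M f =
  map′ (λ (inj , agr) → (λ {i} {j} → inj i j) , agr) (λ (inj , agr) → (λ i j → inj) , agr)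
       (all? (λ i → all? λ j → f i ≟ f j →-dec i ≟ j) ×-dec all? (λ i → all? λ j → M (f i) (f j) ≟ᴮ A i j))

isInduced-∘ : ∀ {n k l} {A : Adjacency n} {M : Adjacency k} {N : Adjacency l} {f g} →
  IsInduced A M f → IsInduced M N g → IsInduced A N (g ∘ f)
isInduced-∘ {f = f} (f-inj , f-adj) (g-inj , g-adj) =
  f-inj ∘ g-inj , λ i j → trans (g-adj (f i) (f j)) (f-adj i j)

isInduced-cong : ∀ {n k} {A : Adjacency n} {M : Adjacency k} {f g : Fin n → Fin k} →
  (∀ i → f i ≡ g i) → IsInduced A M f → IsInduced A M g
isInduced-cong {M = M} f≗g (f-inj , f-adj) =
  (λ {i} {j} e → f-inj (trans (f≗g i) (trans e (sym (f≗g j))))) ,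
  (λ i j → trans (sym (cong₂ M (f≗g i) (f≗g j))) (f-adj i j))

↪-trans : ∀ {n k l} {A : Adjacency n} {M : Adjacency k} {N : Adjacency l} → A ↪ M → M ↪ N → A ↪ N
↪-trans {A = A} {M} {N} (f , f-ind) (g , g-ind) = g ∘ f , isInduced-∘ {A = A} {M} {N} f-ind g-ind

anyVec? : ∀ {k} n {P : Vec (Fin k) n → Set} → (∀ v → Dec (P v)) → Dec (Σ (Vec (Fin k) n) P)
anyVec? zero P? with P? []
... | yes p = yes ([] , p)
... | no ¬p = no λ { ([] , p) → ¬p p }
anyVec? (suc n) P? with any? (λ x → anyVec? n (λ v → P? (x ∷ v)))
... | yes (x , v , p) = yes (x ∷ v , p)
... | no ¬p = no λ { (x ∷ v , p) → ¬p (x , v , p) }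

-- Opaque because lemma5 splits on these decisions, and unfolding the search there is costly.
opaque
  _≤ᵢ?_ : (H G : Graph) → Dec (H ≤ᵢ G)
  H ≤ᵢ? G = map′ (λ (v , ind) → lookup v , ind)
                 (λ (f , ind) → tabulate f , isInduced-cong {A = adj H} {adj G} (λ i → sym (lookup∘tabulate f i)) ind)
                 (anyVec? (size H) λ v → isInduced? (adj H) (adj G) (lookup v))

inducedSubgraph : (G : Graph) {n : ℕ} → (Fin n → V G) → Graph
inducedSubgraph G {n} f = mkGraph n (λ i j → adj G (f i) (f j))

inducedSubgraph-isInduced : (G : Graph) {n : ℕ} (f : Fin n → V G) → Injective _≡_ _≡_ f →
  IsInduced (adj (inducedSubgraph G f)) (adj G) f
inducedSubgraph-isInduced G f f-inj = f-inj , agr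
  where
  agr : ∀ i j → adj G (f i) (f j) ≡ adj (inducedSubgraph G f) i j
  agr i j with i ≟ j
  ... | yes refl = adj-irrefl G (f i)
  ... | no _     = sym (trans (cong (adj G (f i) (f j) ∨_) (adj-sym G (f j) (f i))) (∨-idem _))

record Deletion (G : Graph) (k : ℕ) (ws : Fin k → V G) : Set where
  field
    remainder : Graph
    embedding : remainder ≤ᵢ G
    size≡     : size G ≡ size remainder + k
    avoids    : ∀ x i → proj₁ embedding x ≢ ws i

deleteVertices : ∀ {k} (G : Graph) (ws : Fin k → V G) → Injective _≡_ _≡_ ws → Deletion G k ws
deleteVertices {zero} G ws _ = record
  { remainder = G ; embedding = (λ x → x) , (λ e → e) , (λ _ _ → refl)
  ; size≡ = sym (+-identityʳ (size G)) ; avoids = λ _ () }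
deleteVertices {suc k} (mkGraph zero r) ws _ with () ← ws fz
deleteVertices {suc k} G@(mkGraph (suc n) r) ws ws-inj = record
  { remainder = D.remainder
  ; embedding = punchIn v ∘ f , isInduced-∘ {A = adj D.remainder} {adj G′} {adj G} f-ind G′-ind
  ; size≡ = trans (cong suc D.size≡) (sym (+-suc (size D.remainder) k))
  ; avoids = avoids }
  where
  v = ws fz
  G′ = inducedSubgraph G (punchIn v)
  G′-ind = inducedSubgraph-isInduced G (punchIn v) (punchIn-injective v _ _)
  v≢ws : ∀ i → v ≢ ws (fs i)
  v≢ws i e with () ← ws-inj e
  ws′ : Fin k → Fin n
  ws′ i = punchOut (v≢ws i)
  ws′-inj : Injective _≡_ _≡_ ws′
  ws′-inj {i} {j} e with refl ← ws-inj (trans (sym (punchIn-punchOut (v≢ws i)))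
                                  (trans (cong (punchIn v) e) (punchIn-punchOut (v≢ws j)))) = refl
  module D = Deletion (deleteVertices G′ ws′ ws′-inj)
  f = proj₁ D.embedding
  f-ind = proj₂ D.embedding
  avoids : ∀ x i → punchIn v (f x) ≢ ws i
  avoids x fz       = punchInᵢ≢i v (f x)
  avoids x (fs i) e = D.avoids x i (punchIn-injective v _ _ (trans e (sym (punchIn-punchOut (v≢ws i)))))

-- The new vertex is index 0 and r is its row of adjacencies to the old ones.
extend : ∀ {k} → Adjacency k → Vec Bool k → Adjacency (suc k)
extend M r fz     fz     = false
extend M r fz     (fs j) = lookup r j
extend M r (fs i) fz     = lookup r i
extend M r (fs i) (fs j) = M i j

row : ∀ {k} (G : Graph) → (Fin k → V G) → V G → Vec Bool k
row G f u = tabulate (λ i → adj G u (f i))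

row≡⇒adj : ∀ {k} (G : Graph) (f : Fin k → V G) (u : V G) {r} → row G f u ≡ r → ∀ i → adj G u (f i) ≡ lookup r i
row≡⇒adj G f u refl i = sym (lookup∘tabulate (λ i → adj G u (f i)) i)

extend-isInduced : ∀ {k} (G : Graph) {M : Adjacency k} {f : Fin k → V G} → IsInduced M (adj G) f →
  (u : V G) → (∀ i → u ≢ f i) → IsInduced (extend M (row G f u)) (adj G) (u ◂ f)
extend-isInduced G {f = f} (f-inj , f-adj) u u∉f = inj , agr
  where
  inj : Injective _≡_ _≡_ (u ◂ f)
  inj {fz}   {fz}   _ = refl
  inj {fz}   {fs j} e = ⊥-elim (u∉f j e)
  inj {fs i} {fz}   e = ⊥-elim (u∉f i (sym e))
  inj {fs i} {fs j} e = cong fs (f-inj e)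
  agr : ∀ i j → adj G ((u ◂ f) i) ((u ◂ f) j) ≡ extend _ (row G f u) i j
  agr fz     fz     = adj-irrefl G u
  agr fz     (fs j) = row≡⇒adj G f u refl j
  agr (fs i) fz     = trans (adj-sym G (f i) u) (row≡⇒adj G f u refl i)
  agr (fs i) (fs j) = f-adj i j

Contains : ∀ {k} → List Graph → Adjacency k → Set
Contains Hs M = Any (λ H → adj H ↪ M) Hs

Excludes : List Graph → Graph → Set
Excludes Hs G = All (λ H → ¬ (H ≤ᵢ G)) Hs

excludes⇒¬contains : ∀ {k Hs} {G : Graph} {M : Adjacency k} → Excludes Hs G → M ↪ adj G → ¬ Contains Hs M
excludes⇒¬contains {G = G} {M} ex e c = All¬⇒¬Any ex (Any.map (λ {H} h → ↪-trans {A = adj H} {M} {adj G} h e) c)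

obstacles₃ obstacles₄ : List Graph
obstacles₃ = claw ∷ hammer ∷ C 6 ∷ []
obstacles₄ = P 6 ∷ obstacles₃

-- Backtracking over the vertices of A; the search need not be complete, and soundness is
-- re-established by isInduced?, so no correctness proof of the backtracking is needed.
candidates : ∀ {n k} → Adjacency n → Adjacency k → List (Vec (Fin k) n)
candidates {zero}      A M = [] ∷ []
candidates {suc n} {k} A M = concatMap extensions (candidates (λ i j → A (fs i) (fs j)) M)
  where
  fits : ∀ {m} → (Fin m → Bool) → Vec (Fin k) m → Fin k → Bool
  fits a []      x = true
  fits a (z ∷ v) x = not ⌊ x ≟ z ⌋ ∧ ⌊ M x z ≟ᴮ a fz ⌋ ∧ fits (a ∘ fs) v x
  extensions : Vec (Fin k) n → List (Vec (Fin k) (suc n))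
  extensions v = map (_∷ v) (filterᵇ (fits (A fz ∘ fs) v) (allFin k))

find : ∀ {n k} (A : Adjacency n) (M : Adjacency k) → Maybe (A ↪ M)
find A M = head (mapMaybe certify (candidates A M))
  where
  certify : Vec _ _ → Maybe (A ↪ M)
  certify v = Maybe.map (lookup v ,_) (dec⇒maybe (isInduced? A M (lookup v)))

contains? : ∀ {k} (Hs : List Graph) (M : Adjacency k) → Maybe (Contains Hs M)
contains? []       M = nothing
contains? (H ∷ Hs) M = Maybe.map here (find (adj H) M) <∣> Maybe.map there (contains? Hs M)

_⊎?_ : ∀ {A B : Set} → Maybe A → Maybe B → Maybe (A ⊎ B)
a ⊎? b = Maybe.map inj₁ a <∣> Maybe.map inj₂ b

T-∧→× : ∀ x {y} → T (x ∧ y) → T x × T y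
T-∧→× x = Equivalence.to (T-∧ {x})

allRows : ∀ n → (Vec Bool n → Bool) → Bool
allRows zero    b = b []
allRows (suc n) b = allRows n (b ∘ (true ∷_)) ∧ allRows n (b ∘ (false ∷_))

allRows-sound : ∀ n (b : Vec Bool n → Bool) → T (allRows n b) → ∀ r → T (b r)
allRows-sound zero    b ok []          = ok
allRows-sound (suc n) b ok (true ∷ r)  = allRows-sound n _ (proj₁ (T-∧→× (allRows n _) ok)) r
allRows-sound (suc n) b ok (false ∷ r) = allRows-sound n _ (proj₂ (T-∧→× (allRows n _) ok)) r

byRowSearch : ∀ {n} {P : Vec Bool n → Set} (search : ∀ r → Maybe (P r)) →
  {T (allRows n (is-just ∘ search))} → ∀ r → P r
byRowSearch search {ok} r = to-witness-T (search r) (allRows-sound _ (is-just ∘ search) ok r)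

-- Named by the indices of the neighbours on p₀ … p₄.
data NbhdType : Set where
  n023 n123 n124 n0134 : NbhdType

nbhd : NbhdType → Vec Bool 5
nbhd n023  = true  ∷ false ∷ true  ∷ true  ∷ false ∷ []
nbhd n123  = false ∷ true  ∷ true  ∷ true  ∷ false ∷ []
nbhd n124  = false ∷ true  ∷ true  ∷ false ∷ true  ∷ []
nbhd n0134 = true  ∷ true  ∷ false ∷ true  ∷ true  ∷ []

nbhd-nonempty : ∀ t → Σ (Fin 5) λ i → lookup (nbhd t) i ≡ true
nbhd-nonempty n023  = # 0 , refl
nbhd-nonempty n123  = # 1 , refl
nbhd-nonempty n124  = # 1 , refl
nbhd-nonempty n0134 = # 0 , refl

nbhdType? : (r : Vec Bool 5) → Maybe (Σ NbhdType λ t → r ≡ nbhd t)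
nbhdType? (true  ∷ false ∷ true  ∷ true  ∷ false ∷ []) = just (n023 , refl)
nbhdType? (false ∷ true  ∷ true  ∷ true  ∷ false ∷ []) = just (n123 , refl)
nbhdType? (false ∷ true  ∷ true  ∷ false ∷ true  ∷ []) = just (n124 , refl)
nbhdType? (true  ∷ true  ∷ false ∷ true  ∷ true  ∷ []) = just (n0134 , refl)
nbhdType? _ = nothing

side : NbhdType → Bool
side n0134 = true
side _     = false

allTypes : (NbhdType → Bool) → Bool
allTypes b = b n023 ∧ b n123 ∧ b n124 ∧ b n0134

allTypes-sound : ∀ b → T (allTypes b) → ∀ t → T (b t)
allTypes-sound b ok n023  = proj₁ (T-∧→× (b n023) ok)
allTypes-sound b ok n123  = proj₁ (T-∧→× (b n123) (proj₂ (T-∧→× (b n023) ok)))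
allTypes-sound b ok n124  = proj₁ (T-∧→× (b n124) (proj₂ (T-∧→× (b n123) (proj₂ (T-∧→× (b n023) ok)))))
allTypes-sound b ok n0134 = proj₂ (T-∧→× (b n124) (proj₂ (T-∧→× (b n123) (proj₂ (T-∧→× (b n023) ok)))))

byTypeSearch : ∀ {P : NbhdType → Set} (search : ∀ t → Maybe (P t)) →
  {T (allTypes (is-just ∘ search))} → ∀ t → P t
byTypeSearch search {ok} t = to-witness-T (search t) (allTypes-sound (is-just ∘ search) ok t)

byTypeSearch₂ : ∀ {P : NbhdType → NbhdType → Set} (search : ∀ t t′ → Maybe (P t t′)) →
  {T (allTypes λ t → allTypes λ t′ → is-just (search t t′))} → ∀ t t′ → P t t′
byTypeSearch₂ search {ok} t t′ = to-witness-T (search t t′)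
  (allTypes-sound (is-just ∘ search t) (allTypes-sound (λ t → allTypes (is-just ∘ search t)) ok t) t′)

-- Each search below runs when the file is checked; opacity keeps clients from unfolding it.
opaque
  nbhdOnP5 : (r : Vec Bool 5) →
    r ≡ replicate 5 false ⊎ (Σ NbhdType λ t → r ≡ nbhd t) ⊎ Contains obstacles₄ (extend (adj (P 5)) r)
  nbhdOnP5 = byRowSearch λ r →
    dec⇒maybe (≡-dec-Vec _≟ᴮ_ r (replicate 5 false)) ⊎? (nbhdType? r ⊎? contains? obstacles₄ (extend (adj (P 5)) r))

  adjacentToDetached : ∀ t →
    Contains obstacles₄ (extend (extend (adj (P 5)) (nbhd t)) (true ∷ replicate 5 false))
  adjacentToDetached = byTypeSearch λ t →
    contains? obstacles₄ (extend (extend (adj (P 5)) (nbhd t)) (true ∷ replicate 5 false))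

  nonadjacentTypes : ∀ t t′ →
    side t ≢ side t′ ⊎ Contains obstacles₄ (extend (extend (adj (P 5)) (nbhd t)) (false ∷ nbhd t′))
  nonadjacentTypes = byTypeSearch₂ λ t t′ →
    dec⇒maybe (¬? (side t ≟ᴮ side t′)) ⊎? contains? obstacles₄ (extend (extend (adj (P 5)) (nbhd t)) (false ∷ nbhd t′))

  offP6 : (r : Vec Bool 6) →
    (Σ Bool λ a → Σ Bool λ b → r ≡ a ∷ false ∷ false ∷ false ∷ false ∷ b ∷ [])
    ⊎ Contains obstacles₃ (extend (adj (P 6)) r)
  offP6 = byRowSearch λ r → interior r ⊎? contains? obstacles₃ (extend (adj (P 6)) r)
    where
    interior : (r : Vec Bool 6) → Maybe (Σ Bool λ a → Σ Bool λ b → r ≡ a ∷ false ∷ false ∷ false ∷ false ∷ b ∷ [])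
    interior (a ∷ false ∷ false ∷ false ∷ false ∷ b ∷ []) = just (a , b , refl)
    interior _ = nothing

shift : Fin 6 → Fin 7
shift = lookup (# 2 ∷ # 3 ∷ # 4 ∷ # 5 ∷ # 6 ∷ # 0 ∷ [])

shift-isInduced : ∀ b → IsInduced (adj (P 6)) (extend (adj (P 6)) (b ∷ false ∷ false ∷ false ∷ false ∷ true ∷ [])) shift
shift-isInduced b = toWitness {a? = isInduced? (adj (P 6)) (M b) shift} (check b)
  where
  M : Bool → Adjacency 7
  M b = extend (adj (P 6)) (b ∷ false ∷ false ∷ false ∷ false ∷ true ∷ [])
  check : ∀ b → True (isInduced? (adj (P 6)) (M b) shift)
  check true  = _
  check false = _

P6-neighbours-of-2 : ∀ i → adj (P 6) i (# 2) ≡ true → i ≡ # 1 ⊎ i ≡ # 3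
P6-neighbours-of-2 fz                            ()
P6-neighbours-of-2 (fs fz)                       _ = inj₁ refl
P6-neighbours-of-2 (fs (fs fz))                  ()
P6-neighbours-of-2 (fs (fs (fs fz)))             _ = inj₂ refl
P6-neighbours-of-2 (fs (fs (fs (fs fz))))        ()
P6-neighbours-of-2 (fs (fs (fs (fs (fs fz))))) ()

P6-neighbour-of-5 : ∀ i → adj (P 6) (# 5) i ≡ true → i ≡ # 4
P6-neighbour-of-5 fz                            ()
P6-neighbour-of-5 (fs fz)                       ()
P6-neighbour-of-5 (fs (fs fz))                  ()
P6-neighbour-of-5 (fs (fs (fs fz)))             ()
P6-neighbour-of-5 (fs (fs (fs (fs fz))))        _ = refl
P6-neighbour-of-5 (fs (fs (fs (fs (fs fz))))) ()

bool-pigeonhole : ∀ (a b c : Bool) → a ≡ b ⊎ b ≡ c ⊎ a ≡ c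
bool-pigeonhole false false _     = inj₁ refl
bool-pigeonhole true  true  _     = inj₁ refl
bool-pigeonhole false true  true  = inj₂ (inj₁ refl)
bool-pigeonhole true  false false = inj₂ (inj₁ refl)
bool-pigeonhole false true  false = inj₂ (inj₂ refl)
bool-pigeonhole true  false true  = inj₂ (inj₂ refl)

Least : (ℕ → Set) → ℕ → Set
Least P m = P m × (∀ {k} → k < m → ¬ P k)

leastWitness : ∀ {P : ℕ → Set} → (∀ n → Dec (P n)) → ∀ {n} → P n → ∃ (Least P)
leastWitness {P} P? {n} = <-rec (λ n → P n → ∃ (Least P)) search n
  where
  search : ∀ n → (∀ {k} → k < n → P k → ∃ (Least P)) → P n → ∃ (Least P)
  search n smaller Pn with anyUpTo? P? n
  ... | yes (k , k<n , Pk) = smaller k<n Pk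
  ... | no none = n , Pn , λ k<n Pk → none (_ , k<n , Pk)

-- Graphs with an induced P₅ and no induced P₆

module InducedP5 (G : Graph) (connected : Connected G) (excl : Excludes obstacles₄ G) (e : P 5 ≤ᵢ G) where

  p : Fin 5 → V G
  p = proj₁ e

  Outside : V G → Set
  Outside u = ∀ i → u ≢ p i

  outside? : ∀ u → (Σ (Fin 5) λ i → u ≡ p i) ⊎ Outside u
  outside? u with any? (λ i → u ≟ p i)
  ... | yes on = inj₁ on
  ... | no ¬on = inj₂ λ i u≡pi → ¬on (i , u≡pi)

  Dominated : V G → Set
  Dominated u = (Σ (Fin 5) λ i → u ≡ p i) ⊎ (Σ (Fin 5) λ i → adj G u (p i) ≡ true)

  ¬contains₁ : ∀ {u} → Outside u → ¬ Contains obstacles₄ (extend (adj (P 5)) (row G p u))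
  ¬contains₁ {u} out = excludes⇒¬contains {G = G} excl (u ◂ p , extend-isInduced G (proj₂ e) u out)

  ¬contains₂ : ∀ {u w r s} → Outside u → Outside w → w ≢ u → row G p u ≡ r → adj G w u ∷ row G p w ≡ s →
    ¬ Contains obstacles₄ (extend (extend (adj (P 5)) r) s)
  ¬contains₂ {u} {w} u-out w-out w≢u refl refl =
    excludes⇒¬contains {G = G} excl (w ◂ u ◂ p , extend-isInduced G (extend-isInduced G (proj₂ e) u u-out) w w∉)
    where
    w∉ : ∀ i → w ≢ (u ◂ p) i
    w∉ fz     = w≢u
    w∉ (fs i) = w-out i

  typeOf-dominated : ∀ {u} → Outside u → Dominated u → Σ NbhdType λ t → row G p u ≡ nbhd t
  typeOf-dominated {u} out dom with nbhdOnP5 (row G p u) | dom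
  ... | inj₂ (inj₂ c)  | _ = ⊥-elim (¬contains₁ out c)
  ... | inj₂ (inj₁ ty) | _ = ty
  ... | inj₁ _     | inj₁ (i , u≡pi) = ⊥-elim (out i u≡pi)
  ... | inj₁ empty | inj₂ (i , u~pi)
    with () ← trans (sym u~pi) (trans (row≡⇒adj G p u empty i) (lookup-replicate i false))

  dominated-step : ∀ {x y} → adj G x y ≡ true → Dominated x → Dominated y
  dominated-step {x} {y} x~y x-dom with outside? y | outside? x
  ... | inj₁ on | _ = inj₁ on
  ... | inj₂ _  | inj₁ (i , refl) = inj₂ (i , trans (adj-sym G y (p i)) x~y)
  ... | inj₂ y-out | inj₂ x-out with typeOf-dominated x-out x-dom | nbhdOnP5 (row G p y)
  ... | _ | inj₂ (inj₂ c) = ⊥-elim (¬contains₁ y-out c)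
  ... | t , x-t | inj₁ y-empty = ⊥-elim (¬contains₂ x-out y-out (≢-sym (adj⇒≢ G x~y)) x-t
                                   (cong₂ _∷_ (trans (adj-sym G y x) x~y) y-empty) (adjacentToDetached t))
  ... | _ | inj₂ (inj₁ (t , y-t)) with i , t-i ← nbhd-nonempty t = inj₂ (i , trans (row≡⇒adj G p y y-t i) t-i)

  dominated : ∀ w → Dominated w
  dominated w = Reach-closed G Dominated dominated-step (connected (p fz) w) (inj₁ (fz , refl))

  nonadjacent-sides : ∀ {u w t t′} → Outside u → Outside w → w ≢ u → adj G w u ≡ false →
    row G p u ≡ nbhd t → row G p w ≡ nbhd t′ → side t ≢ side t′
  nonadjacent-sides {t = t} {t′} u-out w-out w≢u w≁u u-t w-t′ with nonadjacentTypes t t′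
  ... | inj₁ sides≢ = sides≢
  ... | inj₂ c = ⊥-elim (¬contains₂ u-out w-out w≢u u-t (cong₂ _∷_ w≁u w-t′) c)

  O₃-free-after-deletion : Deletable (Free (Single (O 3))) 5 G
  O₃-free-after-deletion = D.remainder , D.embedding , ≤-reflexive D.size≡ , O₃-free
    where
    module D = Deletion (deleteVertices G p (proj₁ (proj₂ e)))
    O₃-free : Free (Single (O 3)) D.remainder
    O₃-free .(O 3) refl g = clash-of (bool-pigeonhole (s (# 0)) (s (# 1)) (s (# 2)))
      where
      x : Fin 3 → V G
      x = proj₁ D.embedding ∘ proj₁ g
      x-ind : IsInduced (adj (O 3)) (adj G) x
      x-ind = isInduced-∘ {A = adj (O 3)} {adj D.remainder} {adj G} (proj₂ g) (proj₂ D.embedding)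
      out : ∀ i → Outside (x i)
      out i = D.avoids (proj₁ g i)
      typeAt : ∀ i → Σ NbhdType λ t → row G p (x i) ≡ nbhd t
      typeAt i = typeOf-dominated (out i) (dominated (x i))
      s : Fin 3 → Bool
      s i = side (proj₁ (typeAt i))
      clash : ∀ i j → i ≢ j → s i ≢ s j
      clash i j i≢j = nonadjacent-sides (out i) (out j) (λ e → i≢j (sym (proj₁ x-ind e)))
        (trans (proj₂ x-ind j i) (∧-zeroʳ (not ⌊ j ≟ i ⌋))) (proj₂ (typeAt i)) (proj₂ (typeAt j))
      clash-of : s (# 0) ≡ s (# 1) ⊎ s (# 1) ≡ s (# 2) ⊎ s (# 0) ≡ s (# 2) → ⊥
      clash-of (inj₁ eq)        = clash (# 0) (# 1) (λ ()) eq
      clash-of (inj₂ (inj₁ eq)) = clash (# 1) (# 2) (λ ()) eq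
      clash-of (inj₂ (inj₂ eq)) = clash (# 0) (# 2) (λ ()) eq

CycleStep : ∀ {L} → Fin L → Fin L → Set
CycleStep {L} i j = toℕ j ≡ suc (toℕ i) ⊎ (toℕ i ≡ 0 × suc (toℕ j) ≡ L)

rel-C⁻ : ∀ {L} (i j : Fin L) → T (rel (C L) i j) → CycleStep i j
rel-C⁻ i j h with Equivalence.to (T-∨ {toℕ j ≡ᵇ suc (toℕ i)}) h
... | inj₁ h₁ = inj₁ (≡ᵇ⇒≡ _ _ h₁)
... | inj₂ h₂ with h₂₁ , h₂₂ ← T-∧→× (toℕ i ≡ᵇ 0) h₂ = inj₂ (≡ᵇ⇒≡ _ _ h₂₁ , ≡ᵇ⇒≡ _ _ h₂₂)

rel-C⁺ : ∀ {L} (i j : Fin L) → CycleStep i j → T (rel (C L) i j)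
rel-C⁺ i j (inj₁ e) = Equivalence.from (T-∨ {toℕ j ≡ᵇ suc (toℕ i)}) (inj₁ (≡⇒≡ᵇ _ _ e))
rel-C⁺ i j (inj₂ (e₁ , e₂)) =
  Equivalence.from (T-∨ {toℕ j ≡ᵇ suc (toℕ i)}) (inj₂ (Equivalence.from T-∧ (≡⇒≡ᵇ _ _ e₁ , ≡⇒≡ᵇ _ _ e₂)))

adj-C⁻ : ∀ {L} (i j : Fin L) → adj (C L) i j ≡ true → CycleStep i j ⊎ CycleStep j i
adj-C⁻ i j h with i ≟ j
... | yes _ with () ← h
... | no _ = Sum.map (rel-C⁻ i j) (rel-C⁻ j i) (Equivalence.to (T-∨ {rel (C _) i j}) (Equivalence.from T-≡ h))

adj-C⁺ : ∀ {L} (i j : Fin L) → i ≢ j → CycleStep i j ⊎ CycleStep j i → adj (C L) i j ≡ true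
adj-C⁺ i j i≢j s with i ≟ j
... | yes i≡j = ⊥-elim (i≢j i≡j)
... | no _ = Equivalence.to T-≡ (Equivalence.from (T-∨ {rel (C _) i j}) (Sum.map (rel-C⁺ i j) (rel-C⁺ j i) s))

-- Graphs with an induced P₆ and no pendant vertex

module InducedP6 (G : Graph) (connected : Connected G) (excl : Excludes obstacles₃ G)
  (noPendant : ∀ v → degree G v ≢ 1) (e : P 6 ≤ᵢ G) where

  Window : Set
  Window = adj (P 6) ↪ adj G

  offWindow : (w : Window) {u : V G} → (∀ i → u ≢ proj₁ w i) →
    Σ Bool λ a → Σ Bool λ b → row G (proj₁ w) u ≡ a ∷ false ∷ false ∷ false ∷ false ∷ b ∷ []
  offWindow (q , q-ind) {u} out with offP6 (row G q u)
  ... | inj₁ shape = shape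
  ... | inj₂ c = ⊥-elim (excludes⇒¬contains {G = G} excl (u ◂ q , extend-isInduced G q-ind u out) c)

  middle-neighbours : (w : Window) {u : V G} → adj G u (proj₁ w (# 2)) ≡ true →
    u ≡ proj₁ w (# 1) ⊎ u ≡ proj₁ w (# 3)
  middle-neighbours w@(q , _ , q-adj) {u} u~q₂ with any? (λ i → u ≟ q i)
  ... | yes (i , refl) = Sum.map (cong q) (cong q) (P6-neighbours-of-2 i (trans (sym (q-adj i (# 2))) u~q₂))
  ... | no ¬on with _ , _ , shape ← offWindow w (λ i u≡qi → ¬on (i , u≡qi))
    with () ← trans (sym u~q₂) (row≡⇒adj G q u shape (# 2))

  -- The end q₅ has a second neighbour u, which sees no interior vertex: q₁ … q₅ u is a window.
  slide : Window → Window
  slide (q , q-ind) = (u ◂ q) ∘ shift ,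
    isInduced-∘ {A = adj (P 6)} {extend (adj (P 6)) shape} {adj G} (shift-isInduced (adj G u (q (# 0)))) u-ind
    where
    second = secondNeighbour G (q (# 5)) (q (# 4)) (noPendant (q (# 5))) (proj₂ q-ind (# 5) (# 4))
    u = proj₁ second
    q₅~u = proj₁ (proj₂ second)
    out : ∀ i → u ≢ q i
    out i u≡qi = proj₂ (proj₂ second) (trans u≡qi (cong q (P6-neighbour-of-5 i
      (trans (sym (proj₂ q-ind (# 5) i)) (subst (λ v → adj G (q (# 5)) v ≡ true) u≡qi q₅~u)))))
    shape = adj G u (q (# 0)) ∷ false ∷ false ∷ false ∷ false ∷ true ∷ []
    row≡shape : row G q u ≡ shape
    row≡shape with a , b , row≡ ← offWindow (q , q-ind) out =
      trans row≡ (cong₂ (λ a b → a ∷ false ∷ false ∷ false ∷ false ∷ b ∷ [])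
        (sym (row≡⇒adj G q u row≡ (# 0)))
        (trans (sym (row≡⇒adj G q u row≡ (# 5))) (trans (adj-sym G u (q (# 5))) q₅~u)))
    u-ind : IsInduced (extend (adj (P 6)) shape) (adj G) (u ◂ q)
    u-ind = subst (λ r → IsInduced (extend (adj (P 6)) r) (adj G) (u ◂ q)) row≡shape (extend-isInduced G q-ind u out)

  window : ℕ → Window
  window zero    = e
  window (suc t) = slide (window t)

  y : ℕ → V G
  y t = proj₁ (window t) (# 0)

  y-window : ∀ t (a : Fin 6) → y (toℕ a + t) ≡ proj₁ (window t) a
  y-window t fz                            = refl
  y-window t (fs fz)                       = refl
  y-window t (fs (fs fz))                  = refl
  y-window t (fs (fs (fs fz)))             = refl
  y-window t (fs (fs (fs (fs fz))))        = refl
  y-window t (fs (fs (fs (fs (fs fz))))) = refl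

  y-adjacent : ∀ t → adj G (y t) (y (suc t)) ≡ true
  y-adjacent t = proj₂ (proj₂ (window t)) (# 0) (# 1)

  y-neighbours : ∀ {t w} → 2 ≤ t → adj G w (y t) ≡ true → w ≡ y (pred t) ⊎ w ≡ y (suc t)
  y-neighbours {suc (suc m)} (s≤s (s≤s z≤n)) = middle-neighbours (window m)

  y-gap : ∀ {s t} → s < t → y s ≡ y t → 6 + s ≤ t
  y-gap {s} {t} s<t ys≡yt with 6 + s ≤? t
  ... | yes 6+s≤t = 6+s≤t
  ... | no 6+s≰t = ⊥-elim (<-irrefl (sym t≡s) s<t)
    where
    d+s≡t : (t ∸ s) + s ≡ t
    d+s≡t = m∸n+n≡m (<⇒≤ s<t)
    d<6 : t ∸ s < 6
    d<6 = +-cancelʳ-< s (t ∸ s) 6 (subst (_< 6 + s) (sym d+s≡t) (≰⇒> 6+s≰t))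
    a = fromℕ< d<6
    0≡a : # 0 ≡ a
    0≡a = proj₁ (proj₂ (window s))
      (trans ys≡yt (trans (cong y (sym (trans (cong (_+ s) (toℕ-fromℕ< d<6)) d+s≡t))) (y-window s a)))
    t≡s : t ≡ s
    t≡s = trans (sym d+s≡t) (cong (_+ s) (trans (sym (toℕ-fromℕ< d<6)) (cong toℕ (sym 0≡a))))

  y-2-apart : ∀ t → y t ≢ y (2 + t)
  y-2-apart t eq with s≤s (s≤s ()) ← +-cancelʳ-≤ t 6 2 (y-gap (m<n+m t z<s) eq)

  Repeats : ℕ → Set
  Repeats t = ∃ λ s → s < t × y s ≡ y t

  repeats : ∃ Repeats
  repeats with i , j , i<j , yi≡yj ← pigeonhole (n<1+n (size G)) (λ i → y (toℕ i)) =
    toℕ j , toℕ i , i<j , yi≡yj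

  -- At a first repetition y I ≡ y L with I ≥ 1, the neighbours of y I give an earlier one.
  firstReturn : ∃ λ L → 0 < L × y L ≡ y 0 × (∀ {s t} → s < t → t < L → y s ≢ y t)
  firstReturn with L , (I , I<L , yI≡yL) , first ← leastWitness (λ t → anyUpTo? (λ s → y s ≟ y t) t) (proj₂ repeats) =
    L , <-≤-trans z<s I<L , returns I L I<L yI≡yL first , λ s<t t<L ys≡yt → first t<L (_ , s<t , ys≡yt)
    where
    returns : ∀ I L → I < L → y I ≡ y L → (∀ {k} → k < L → ¬ Repeats k) → y L ≡ y 0
    returns zero L _ yI≡yL _ = sym yI≡yL
    returns 1 1 (s≤s ()) _ _
    returns 1 L@(suc (suc m)) I<L y₁≡yL first
      with y-gap I<L y₁≡yL
         | y-neighbours {L} (s≤s (s≤s z≤n)) (subst (λ v → adj G (y 0) v ≡ true) y₁≡yL (y-adjacent 0))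
         | y-neighbours {L} (s≤s (s≤s z≤n))
             (subst (λ v → adj G (y 2) v ≡ true) y₁≡yL (trans (adj-sym G (y 2) (y 1)) (y-adjacent 1)))
    ... | _ | inj₁ y₀≡ | _ = ⊥-elim (first (n<1+n (suc m)) (0 , z<s , y₀≡))
    ... | s≤s (s≤s gap) | _ | inj₁ y₂≡ = ⊥-elim (first (n<1+n (suc m)) (2 , s≤s (≤-trans (s≤s (s≤s z≤n)) gap) , y₂≡))
    ... | _ | inj₂ y₀≡ | inj₂ y₂≡ = ⊥-elim (y-2-apart 0 (trans y₀≡ (sym y₂≡)))
    returns (suc (suc m)) (suc L′) I<L yI≡yL first
      with s≤s gap ← y-gap I<L yI≡yL
      with y-neighbours {2 + m} (s≤s (s≤s z≤n)) (subst (λ v → adj G (y L′) v ≡ true) (sym yI≡yL) (y-adjacent L′))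
    ... | inj₁ y≡ = ⊥-elim (first (n<1+n L′) (suc m , m+n≤o⇒n≤o 5 gap , sym y≡))
    ... | inj₂ y≡ = ⊥-elim (first (n<1+n L′) (3 + m , m+n≤o⇒n≤o 3 gap , sym y≡))

  module Closed (L′ : ℕ) (closes : y (suc L′) ≡ y 0)
    (injective-below : ∀ {s t} → s < t → t < suc L′ → y s ≢ y t) where

    L : ℕ
    L = suc L′

    6≤L : 6 ≤ L
    6≤L = y-gap z<s (sym closes)

    2≤L : 2 ≤ L
    2≤L = ≤-trans (s≤s (s≤s z≤n)) 6≤L

    periodic₂ : ∀ t → y (t + L) ≡ y t × y (suc t + L) ≡ y (suc t)
    periodic₂ zero with y-neighbours {L} 2≤L (subst (λ v → adj G (y 1) v ≡ true) (sym closes)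
                          (trans (adj-sym G (y 1) (y 0)) (y-adjacent 0)))
    ... | inj₁ y₁≡ = ⊥-elim (injective-below (≤-trans (s≤s (s≤s z≤n)) (s≤s⁻¹ 6≤L)) (n<1+n L′) y₁≡)
    ... | inj₂ y₁≡ = closes , sym y₁≡
    periodic₂ (suc t) with _ , current ← periodic₂ t
      with y-neighbours {suc t + L} (≤-trans 2≤L (m≤n+m L (suc t)))
             (subst (λ v → adj G (y (2 + t)) v ≡ true) (sym current)
               (trans (adj-sym G (y (2 + t)) (y (suc t))) (y-adjacent (suc t))))
    ... | inj₁ y≡ = ⊥-elim (y-2-apart t (sym (trans y≡ (proj₁ (periodic₂ t)))))
    ... | inj₂ y≡ = current , sym y≡

    periodic : ∀ t → y (t + L) ≡ y t
    periodic t = proj₁ (periodic₂ t)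

    periodic-multiple : ∀ r k → y (r + k * L) ≡ y r
    periodic-multiple r zero    = cong y (+-identityʳ r)
    periodic-multiple r (suc k) = begin
      y (r + (L + k * L)) ≡⟨ cong y (trans (cong (r +_) (+-comm L (k * L))) (sym (+-assoc r (k * L) L))) ⟩
      y (r + k * L + L)   ≡⟨ periodic (r + k * L) ⟩
      y (r + k * L)       ≡⟨ periodic-multiple r k ⟩
      y r                 ∎
      where open ≡-Reasoning

    y-injective : ∀ {s t} → s < L → t < L → y s ≡ y t → s ≡ t
    y-injective {s} {t} s<L t<L ys≡yt with <-cmp s t
    ... | tri< s<t _ _ = ⊥-elim (injective-below s<t t<L ys≡yt)
    ... | tri≈ _ s≡t _ = s≡t
    ... | tri> _ _ t<s = ⊥-elim (injective-below t<s s<L (sym ys≡yt))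

    c : Fin L → V G
    c i = y (toℕ i)

    InCycle : V G → Set
    InCycle w = Σ (Fin L) λ i → c i ≡ w

    y-inCycle : ∀ t → InCycle (y t)
    y-inCycle t = fromℕ< (m%n<n t L) ,
      trans (cong y (toℕ-fromℕ< (m%n<n t L)))
        (trans (sym (periodic-multiple (t % L) (t / L))) (cong y (sym (m≡m%n+[m/n]*n t L))))

    inCycle-step : ∀ {x w} → adj G x w ≡ true → InCycle x → InCycle w
    inCycle-step {w = w} x~w (i , refl)
      with y-neighbours {toℕ i + L} (≤-trans 2≤L (m≤n+m L (toℕ i)))
             (subst (λ v → adj G w v ≡ true) (sym (periodic (toℕ i))) (trans (adj-sym G w (c i)) x~w))
    ... | inj₁ w≡ = subst InCycle (sym w≡) (y-inCycle (pred (toℕ i + L)))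
    ... | inj₂ w≡ = subst InCycle (sym w≡) (y-inCycle (suc (toℕ i + L)))

    surjective : ∀ w → InCycle w
    surjective w = Reach-closed G InCycle inCycle-step (connected (y 0) w) (# 0 , refl)

    c-adjacent : ∀ i j → CycleStep i j → adj G (c i) (c j) ≡ true
    c-adjacent i j (inj₁ j≡1+i) = subst (λ n → adj G (c i) (y n) ≡ true) (sym j≡1+i) (y-adjacent (toℕ i))
    c-adjacent i j (inj₂ (i≡0 , 1+j≡L)) =
      trans (cong (λ v → adj G v (c j)) (trans (cong y i≡0) (trans (sym closes) (cong y (sym 1+j≡L)))))
        (trans (adj-sym G (y (suc (toℕ j))) (c j)) (y-adjacent (toℕ j)))

    c-adjacent⁻ : ∀ i j → adj G (c i) (c j) ≡ true → CycleStep i j ⊎ CycleStep j i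
    c-adjacent⁻ i j ci~cj
      with y-neighbours {toℕ i + L} (≤-trans 2≤L (m≤n+m L (toℕ i)))
             (subst (λ v → adj G (c j) v ≡ true) (sym (periodic (toℕ i))) (trans (adj-sym G (c j) (c i)) ci~cj))
    ... | inj₂ cj≡ with m≤n⇒m<n∨m≡n (toℕ<n i)
    ...   | inj₁ 1+i<L = inj₁ (inj₁ (y-injective (toℕ<n j) 1+i<L (trans cj≡ (periodic (suc (toℕ i))))))
    ...   | inj₂ 1+i≡L = inj₂ (inj₂ (y-injective (toℕ<n j) z<s
                           (trans cj≡ (trans (periodic (suc (toℕ i))) (trans (cong y 1+i≡L) closes))) , 1+i≡L))
    c-adjacent⁻ i j _ | inj₁ cj≡ with toℕ i in i≡
    ... | zero  = inj₁ (inj₂ (refl , cong suc (y-injective (toℕ<n j) (n<1+n L′) cj≡)))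
    ... | suc k = inj₂ (inj₁ (cong suc (sym (y-injective (toℕ<n j) k<L (trans cj≡ (periodic k))))))
      where
      k<L : k < L
      k<L = <-trans (n<1+n k) (subst (_< L) i≡ (toℕ<n i))

    c-adj : ∀ i j → adj G (c i) (c j) ≡ adj (C L) i j
    c-adj i j = ⇔→≡ (mk⇔
      (λ ci~cj → adj-C⁺ i j (λ i≡j → adj⇒≢ G ci~cj (cong c i≡j)) (c-adjacent⁻ i j ci~cj))
      (λ ij → Sum.[ c-adjacent i j , (λ ji → trans (adj-sym G (c i) (c j)) (c-adjacent j i ji)) ] (adj-C⁻ i j ij)))

    isomorphic : G ≅ C L
    isomorphic = mk↔ₛ′ index c index∘c (proj₂ ∘ surjective) ,
      λ v w → trans (sym (c-adj (index v) (index w))) (cong₂ (adj G) (proj₂ (surjective v)) (proj₂ (surjective w)))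
      where
      index : V G → Fin L
      index w = proj₁ (surjective w)
      index∘c : ∀ i → index (c i) ≡ i
      index∘c i = toℕ-injective (y-injective (toℕ<n _) (toℕ<n i) (proj₂ (surjective (c i))))

  chordlessCycle : IsChordlessCycle G
  chordlessCycle with suc L′ , _ , closes , injective-below ← firstReturn =
    suc L′ , ≤-trans (s≤s (s≤s (s≤s z≤n))) 6≤L , isomorphic
    where open Closed L′ closes injective-below

excludes₃ : ∀ {G} → Free ClawOrHammer G → ¬ (C 6 ≤ᵢ G) → Excludes obstacles₃ G
excludes₃ free ¬c6 = free claw (inj₁ refl) ∷ free hammer (inj₂ refl) ∷ ¬c6 ∷ []

lemma5 : (G : Graph) → Connected G → Free ClawOrHammer G →
    IsChordlessCycle G
    ⊎ (C 6 ≤ᵢ G)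
    ⊎ (Σ (V G) λ v → degree G v ≡ 1)
    ⊎ Free (Single (P 5)) G
    ⊎ Deletable (Free (Single (O 3))) 5 G
lemma5 G connected free with any? (λ v → degree G v ≟ℕ 1) | C 6 ≤ᵢ? G | P 6 ≤ᵢ? G | P 5 ≤ᵢ? G
... | yes pendant | _ | _ | _ = inj₂ (inj₂ (inj₁ pendant))
... | no _ | yes c6 | _ | _ = inj₂ (inj₁ c6)
... | no ¬pendant | no ¬c6 | yes p6 | _ =
  inj₁ (InducedP6.chordlessCycle G connected (excludes₃ {G} free ¬c6) (λ v d → ¬pendant (v , d)) p6)
... | no _ | no ¬c6 | no ¬p6 | yes p5 =
  inj₂ (inj₂ (inj₂ (inj₂ (InducedP5.O₃-free-after-deletion G connected (¬p6 ∷ excludes₃ {G} free ¬c6) p5))))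
... | no _ | no _ | no _ | no ¬p5 = inj₂ (inj₂ (inj₂ (inj₁ λ { .(P 5) refl → ¬p5 })))
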